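{- Let $G=(V,E)$ be a finite directed graph. Every vertex $v\in V$ is the entrance of at most one superbubble of $G$, and every vertex $v\in V$ is the exit of at most one superbubble of $G$.
   Context: "Passing through" a vertex means visiting it and then leaving it (not merely arriving at it or merely starting from it). An ordered pair of distinct vertices $(s,t)$ of $G$ satisfies the superbubble conditions if: (reachability) $t$ is reachable from $s$; (matching) the set $U$ of vertices reachable from $s$ without passing through $t$ equals the set of vertices from which $t$ is reachable without passing through $s$; (acyclicity) the subgraph of $G$ induced by $U$ is acyclic; (minimality) no vertex $v\in U$ other than $t$ is such that $(s,v)$ satisfies the reachability, matching and acyclicity conditions. For such a pair, the subgraph induced by $U$ is called a superbubble, denoted $\langle s,t\rangle$, with entrance $s$ and exit $t$; distinct such pairs yield distinct superbubbles. -}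

module Defs where

open import Data.Nat using (ℕ)
open import Data.Fin using (Fin)
open import Data.Bool using (Bool; T)
open import Data.Product using (_×_)
open import Data.Sum using (_⊎_)
open import Relation.Nullary using (¬_)
open import Relation.Binary.PropositionalEquality using (_≡_; _≢_)

-- A finite directed graph: vertex set Fin n, adjacency given by a Boolean
-- matrix (parallel edges are irrelevant for all notions below; loops allowed).
Graph : ℕ → Set
Graph n = Fin n → Fin n → Bool

module _ {n : ℕ} (G : Graph n) where

  Edge : Fin n → Fin n → Set
  Edge a b = T (G a b)

  data Walk : Fin n → Fin n → Set where
    edge : ∀ {a b} → Edge a b → Walk a b
    step : ∀ {a c b} → Edge a c → Walk c b → Walk a b

  Reach : Fin n → Fin n → Set
  Reach a b = (a ≡ b) ⊎ Walk a b

  -- Nonempty walk from a to b that does not pass through x, i.e. x does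
  -- not occur as an interior vertex (arriving at / starting from x is fine).
  data WalkAvoid (x : Fin n) : Fin n → Fin n → Set where
    edge : ∀ {a b} → Edge a b → WalkAvoid x a b
    step : ∀ {a c b} → Edge a c → c ≢ x → WalkAvoid x c b → WalkAvoid x a b

  ReachAvoid : Fin n → Fin n → Fin n → Set
  ReachAvoid x a b = (a ≡ b) ⊎ WalkAvoid x a b

  InU : Fin n → Fin n → Fin n → Set
  InU s t u = ReachAvoid t s u

  data WalkIn (P : Fin n → Set) : Fin n → Fin n → Set where
    edge : ∀ {a b} → P a → P b → Edge a b → WalkIn P a b
    step : ∀ {a c b} → P a → Edge a c → WalkIn P c b → WalkIn P a b

  AcyclicOn : (Fin n → Set) → Set
  AcyclicOn P = ∀ v → ¬ WalkIn P v v

  ReachabilityCond : Fin n → Fin n → Set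
  ReachabilityCond s t = Reach s t

  MatchingCond : Fin n → Fin n → Set
  MatchingCond s t = ∀ u → (InU s t u → ReachAvoid s u t) × (ReachAvoid s u t → InU s t u)

  AcyclicityCond : Fin n → Fin n → Set
  AcyclicityCond s t = AcyclicOn (InU s t)

  PreBubble : Fin n → Fin n → Set
  PreBubble s t = s ≢ t × ReachabilityCond s t × MatchingCond s t × AcyclicityCond s t

  MinimalityCond : Fin n → Fin n → Set
  MinimalityCond s t = ∀ v → InU s t v → v ≢ t → ¬ PreBubble s v

  Superbubble : Fin n → Fin n → Set
  Superbubble s t = PreBubble s t × MinimalityCond s t

-- If ⟨s,t⟩ and ⟨s,t′⟩ are superbubbles with t ≠ t′, a walk from s to t′ meets
-- one of t, t′ first; that vertex lies in the other pair's set U and violates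
-- its minimality.  For a common exit t with entrances s ≠ s′, a walk from s′ to
-- t shows (using matching) that one entrance, say s′, lies in U(s,t).  Then
-- every walk from s to t passes through s′, since otherwise matching for (s′,t)
-- closes a cycle through s inside U(s,t); from this the conditions for (s,t)
-- transfer to (s,s′), so (s,s′) satisfies the reachability, matching and
-- acyclicity conditions, again contradicting minimality.
module Submission where

open import Defs
open import Data.Nat using (ℕ)
open import Data.Fin using (Fin; _≟_)
open import Data.Product using (_×_; _,_; proj₁; proj₂)
open import Data.Sum using (_⊎_; inj₁; inj₂; reduce)
open import Data.Empty using (⊥-elim)
open import Relation.Nullary using (¬_; yes; no)
open import Relation.Binary.PropositionalEquality using (_≡_; _≢_; refl; sym; ≢-sym)

module _ {n : ℕ} (G : Graph n) where

  walkAvoid⇒walk : ∀ {x a b} → WalkAvoid G x a b → Walk G a b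
  walkAvoid⇒walk (edge e)     = edge e
  walkAvoid⇒walk (step e _ w) = step e (walkAvoid⇒walk w)

  reachAvoid⇒walkAvoid : ∀ {x a b} → a ≢ b → ReachAvoid G x a b → WalkAvoid G x a b
  reachAvoid⇒walkAvoid a≢b (inj₁ a≡b) = ⊥-elim (a≢b a≡b)
  reachAvoid⇒walkAvoid _   (inj₂ w)   = w

  walkAvoid-++ : ∀ {x a c b} → WalkAvoid G x a c → c ≢ x → WalkAvoid G x c b → WalkAvoid G x a b
  walkAvoid-++ (edge e)       c≢x w = step e c≢x w
  walkAvoid-++ (step e d≢x v) c≢x w = step e d≢x (walkAvoid-++ v c≢x w)

  reachAvoid-++ : ∀ {x a c b} → ReachAvoid G x a c → c ≢ x → WalkAvoid G x c b → WalkAvoid G x a b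
  reachAvoid-++ (inj₁ refl) _   w = w
  reachAvoid-++ (inj₂ v)    c≢x w = walkAvoid-++ v c≢x w

  reachAvoid-∷ʳ : ∀ {x a c b} → ReachAvoid G x a c → c ≢ x → Edge G c b → ReachAvoid G x a b
  reachAvoid-∷ʳ r c≢x e = inj₂ (reachAvoid-++ r c≢x (edge e))

  first-hit : ∀ {a b} x y → Walk G a b → b ≡ x ⊎ b ≡ y → WalkAvoid G y a x ⊎ WalkAvoid G x a y
  first-hit x y (edge e) (inj₁ refl) = inj₁ (edge e)
  first-hit x y (edge e) (inj₂ refl) = inj₂ (edge e)
  first-hit x y (step {c = c} e w) b∈xy with c ≟ x | c ≟ y
  ... | yes refl | _        = inj₁ (edge e)
  ... | no _     | yes refl = inj₂ (edge e)
  ... | no c≢x   | no c≢y   with first-hit x y w b∈xy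
  ...   | inj₁ v = inj₁ (step e c≢y v)
  ...   | inj₂ v = inj₂ (step e c≢x v)

  walk⇒avoid-target : ∀ {a b} → Walk G a b → WalkAvoid G b a b
  walk⇒avoid-target w = reduce (first-hit _ _ w (inj₁ refl))

  avoid-or-prefix : ∀ {x a b} y → WalkAvoid G x a b → WalkAvoid G y a b ⊎ WalkAvoid G x a y
  avoid-or-prefix y (edge e) = inj₁ (edge e)
  avoid-or-prefix y (step {c = c} e c≢x w) with c ≟ y
  ... | yes refl = inj₂ (edge e)
  ... | no c≢y with avoid-or-prefix y w
  ...   | inj₁ w′     = inj₁ (step e c≢y w′)
  ...   | inj₂ prefix = inj₂ (step e c≢x prefix)

  avoid-or-suffix : ∀ {x a b} y → WalkAvoid G x a b → WalkAvoid G y a b ⊎ WalkAvoid G x y b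
  avoid-or-suffix y (edge e) = inj₁ (edge e)
  avoid-or-suffix y (step {c = c} e c≢x w) with c ≟ y
  ... | yes refl = inj₂ w
  ... | no c≢y with avoid-or-suffix y w
  ...   | inj₁ w′     = inj₁ (step e c≢y w′)
  ...   | inj₂ suffix = inj₂ suffix

  walkIn-map : ∀ {P Q : Fin n → Set} {a b} → (∀ {v} → P v → Q v) → WalkIn G P a b → WalkIn G Q a b
  walkIn-map f (edge pa pb e) = edge (f pa) (f pb) e
  walkIn-map f (step pa e w)  = step (f pa) e (walkIn-map f w)

  walkIn-++ : ∀ {P : Fin n → Set} {a c b} → WalkIn G P a c → WalkIn G P c b → WalkIn G P a b
  walkIn-++ (edge pa _ e) w = step pa e w
  walkIn-++ (step pa e v) w = step pa e (walkIn-++ v w)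

  walkAvoid⇒walkIn-U : ∀ {s t a b} → InU G s t a → a ≢ t → WalkAvoid G t a b → WalkIn G (InU G s t) a b
  walkAvoid⇒walkIn-U a∈U a≢t (edge e) = edge a∈U (reachAvoid-∷ʳ a∈U a≢t e) e
  walkAvoid⇒walkIn-U a∈U a≢t (step e c≢t w) = step a∈U e (walkAvoid⇒walkIn-U (reachAvoid-∷ʳ a∈U a≢t e) c≢t w)

  walkAvoid⇒walkIn : ∀ {P : Fin n → Set} {x a b} →
                     (∀ {c} → ReachAvoid G x c b → P c) → WalkAvoid G x a b → WalkIn G P a b
  walkAvoid⇒walkIn P⊇ (edge e)       = edge (P⊇ (inj₂ (edge e))) (P⊇ (inj₁ refl)) e
  walkAvoid⇒walkIn P⊇ (step e c≢x w) = step (P⊇ (inj₂ (step e c≢x w))) e (walkAvoid⇒walkIn P⊇ w)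

  module InnerEntrance
    {s s′ t : Fin n}
    (s≢t : s ≢ t) (match : MatchingCond G s t) (acyclic : AcyclicityCond G s t)
    (s′≢t : s′ ≢ t) (match′ : MatchingCond G s′ t)
    (s≢s′ : s ≢ s′) (s′∈U : InU G s t s′)
    where

    s→s′ : WalkAvoid G t s s′
    s→s′ = reachAvoid⇒walkAvoid s≢s′ s′∈U

    s′→t : WalkAvoid G s s′ t
    s′→t = reachAvoid⇒walkAvoid s′≢t (proj₁ (match s′) s′∈U)

    -- Matching for (s′,t) would give a walk from s′ back to s, closing a cycle in U(s,t).
    s→t-passes-s′ : ¬ WalkAvoid G s′ s t
    s→t-passes-s′ w with proj₂ (match′ s) (inj₂ w)
    ... | inj₁ s′≡s = s≢s′ (sym s′≡s)
    ... | inj₂ s′→s = acyclic s (walkAvoid⇒walkIn-U (inj₁ refl) s≢t (walkAvoid-++ s→s′ s′≢t s′→s))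

    t∉U[s,s′] : ¬ InU G s s′ t
    t∉U[s,s′] (inj₁ s≡t) = s≢t s≡t
    t∉U[s,s′] (inj₂ w)   = s→t-passes-s′ w

    U[s,s′]⊆U[s,t] : ∀ {u} → InU G s s′ u → InU G s t u
    U[s,s′]⊆U[s,t] (inj₁ s≡u) = inj₁ s≡u
    U[s,s′]⊆U[s,t] (inj₂ w) with avoid-or-prefix t w
    ... | inj₁ w′  = inj₂ w′
    ... | inj₂ s→t = ⊥-elim (s→t-passes-s′ s→t)

    reaches-s′⇒U[s,t] : ∀ {c} → ReachAvoid G s c s′ → InU G s t c
    reaches-s′⇒U[s,t] r = proj₂ (match _) (inj₂ (reachAvoid-++ r (≢-sym s≢s′) s′→t))

    U[s,s′]-reaches-s′ : ∀ u → InU G s s′ u → ReachAvoid G s u s′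
    U[s,s′]-reaches-s′ u u∈U with u ≟ s′
    ... | yes u≡s′ = inj₁ u≡s′
    ... | no u≢s′ with proj₁ (match u) (U[s,s′]⊆U[s,t] u∈U)
    ...   | inj₁ refl = ⊥-elim (t∉U[s,s′] u∈U)
    ...   | inj₂ u→t with avoid-or-prefix s′ u→t
    ...     | inj₂ u→s′ = inj₂ u→s′
    ...     | inj₁ u→t′ = ⊥-elim (s→t-passes-s′ (reachAvoid-++ u∈U u≢s′ u→t′))

    -- A walk s → u through s′ with u → s′ avoiding s would be a cycle in U(s,t).
    reaches-s′⇒U[s,s′] : ∀ u → ReachAvoid G s u s′ → InU G s s′ u
    reaches-s′⇒U[s,s′] u (inj₁ refl) = inj₂ (walk⇒avoid-target (walkAvoid⇒walk s→s′))
    reaches-s′⇒U[s,s′] u (inj₂ u→s′) with reaches-s′⇒U[s,t] (inj₂ u→s′)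
    ... | inj₁ s≡u = inj₁ s≡u
    ... | inj₂ s→u with avoid-or-suffix s′ s→u
    ...   | inj₁ s→u′ = inj₂ s→u′
    ...   | inj₂ s′→u = ⊥-elim (acyclic u (walkIn-++ (walkAvoid⇒walkIn reaches-s′⇒U[s,t] u→s′)
                                                     (walkAvoid⇒walkIn-U s′∈U s′≢t s′→u)))

    preBubble : PreBubble G s s′
    preBubble = s≢s′
              , inj₂ (walkAvoid⇒walk s→s′)
              , (λ u → U[s,s′]-reaches-s′ u , reaches-s′⇒U[s,s′] u)
              , λ v cycle → acyclic v (walkIn-map U[s,s′]⊆U[s,t] cycle)

  preBubble-inner-entrance : ∀ {s s′ t} → PreBubble G s t → PreBubble G s′ t →
                             s ≢ s′ → InU G s t s′ → PreBubble G s s′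
  preBubble-inner-entrance (s≢t , _ , match , acyclic) (s′≢t , _ , match′ , _) =
    InnerEntrance.preBubble s≢t match acyclic s′≢t match′

  exit-unique : ∀ {s t t′} → Superbubble G s t → Superbubble G s t′ → t ≡ t′
  exit-unique {t = t} {t′} (pb , minimal) (pb′@(s≢t′ , reach′ , _) , minimal′) with t ≟ t′ | reach′
  ... | yes t≡t′ | _         = t≡t′
  ... | no _     | inj₁ s≡t′ = ⊥-elim (s≢t′ s≡t′)
  ... | no t≢t′  | inj₂ s→t′ with first-hit t′ t s→t′ (inj₁ refl)
  ...   | inj₁ t′∈U = ⊥-elim (minimal t′ (inj₂ t′∈U) (≢-sym t≢t′) pb′)
  ...   | inj₂ t∈U′ = ⊥-elim (minimal′ t (inj₂ t∈U′) t≢t′ pb)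

  entrance-unique : ∀ {s s′ t} → Superbubble G s t → Superbubble G s′ t → s ≡ s′
  entrance-unique {s} {s′} {t} (pb@(s≢t , _ , match , _) , minimal) (pb′@(s′≢t , reach′ , _) , minimal′)
    with s ≟ s′ | reach′
  ... | yes s≡s′ | _         = s≡s′
  ... | no _     | inj₁ s′≡t = ⊥-elim (s′≢t s′≡t)
  ... | no s≢s′  | inj₂ s′→t with first-hit t s s′→t (inj₁ refl)
  ...   | inj₁ s′→t-avoiding-s =
    let s′∈U = proj₂ (match s′) (inj₂ s′→t-avoiding-s)
    in ⊥-elim (minimal s′ s′∈U s′≢t (preBubble-inner-entrance pb pb′ s≢s′ s′∈U))
  ...   | inj₂ s∈U′ =
    ⊥-elim (minimal′ s (inj₂ s∈U′) s≢t (preBubble-inner-entrance pb′ pb (≢-sym s≢s′) (inj₂ s∈U′)))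

mainTheorem2 : (n : ℕ) (G : Graph n) →
    ((s t t′ : Fin n) → Superbubble G s t → Superbubble G s t′ → t ≡ t′)
    × ((t s s′ : Fin n) → Superbubble G s t → Superbubble G s′ t → s ≡ s′)
mainTheorem2 n G = (λ _ _ _ → exit-unique G) , (λ _ _ _ → entrance-unique G)
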